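{- Let $F$ be a graph with $\gamma(F)=1$ and $k=|E(F)|\ge 3$, and let $G$ be a pure $(m,F)$-special graph or a copy of $F+e$ for some $e\in E(\overline{F})$. Then for each $x\in V(G)$: (a) $G$ has a minimum $F$-isolating set $D$ with $x\in D$; and (b) if $G$ is a pure $(m,F)$-special graph and $x$ is not a vertex of the quotient graph of $G$ (for any representation of $G$ as a pure $(m,F)$-special graph), then $\iota(G-x,F)=\iota(G,F)-1$.
   Context: All graphs are finite and simple. A copy of $F$ in a graph is a subgraph isomorphic to $F$. $N[D]$ denotes the closed neighbourhood of a vertex set $D$. A set $D\subseteq V(G)$ is an $F$-isolating set of $G$ if $G-N[D]$ contains no copy of $F$; it is minimum if of smallest size, and $\iota(G,F)$ is that size. $\gamma(F)=1$ means $F$ has a vertex adjacent to all other vertices of $F$. $\overline{F}$ is the complement of $F$; for $e\in E(\overline{F})$, $F+e=(V(F),E(F)\cup\{e\})$. Pure $(m,F)$-special graph: for an integer $q\ge 1$ with $m+1=q(k+2)$, take distinct vertices $v_1,\dots,v_q$, copies $F_1,\dots,F_q$ of $F$ whose vertex sets are pairwise disjoint and disjoint from $\{v_1,\dots,v_q\}$, vertices $w_i\in V(F_i)$, and a tree $T$ with vertex set $\{v_1,\dots,v_q\}$ (the quotient graph). The graph with vertex set $\{v_1,\dots,v_q\}\cup\bigcup_i V(F_i)$ and edge set $E(T)\cup\bigcup_i (E(F_i)\cup\{v_iw_i\})$ is a pure $(m,F)$-special graph (with this representation); the subgraphs $G_i$ on $\{v_i\}\cup V(F_i)$ with edges $E(F_i)\cup\{v_iw_i\}$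 are its $F$-constituents. -}

module Defs where

open import Data.Nat using (ℕ; zero; suc; _+_; _*_; _≤_; _<ᵇ_; pred)
open import Data.Bool using (Bool; true; false; _∧_; _∨_; if_then_else_)
open import Data.Fin using (Fin; zero; suc; toℕ; punchIn; inject₁; fromℕ; _≟_)
open import Data.Fin.Subset using (Subset; _∈_; _∉_; ∣_∣)
open import Data.List using (List; map; allFin)
open import Data.Nat.ListAction using (sum)
open import Data.Product using (Σ; _×_; _,_)
open import Data.Sum using (_⊎_; inj₁; inj₂)
open import Relation.Nullary using (¬_)
open import Relation.Nullary.Decidable using (⌊_⌋)
open import Relation.Binary.PropositionalEquality using (_≡_; _≢_)
open import Function.Bundles using (_↔_; Inverse)

Graph : ℕ → Set
Graph n = Fin n → Fin n → Bool

SimpleGraph : ∀ {n} → Graph n → Set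
SimpleGraph {n} G = (∀ (i j : Fin n) → G i j ≡ G j i) × (∀ (i : Fin n) → G i i ≡ false)

edgeCount : ∀ {n} → Graph n → ℕ
edgeCount {n} G =
  sum (map (λ i → sum (map (λ j → if G i j ∧ (toℕ i <ᵇ toℕ j) then 1 else 0)
                           (allFin n)))
           (allFin n))

DominationNumberOne : ∀ {n} → Graph n → Set
DominationNumberOne {n} F = Σ (Fin n) λ c → ∀ (v : Fin n) → v ≢ c → F c v ≡ true

InClosedNbhd : ∀ {n} → Graph n → Subset n → Fin n → Set
InClosedNbhd {n} G D v = v ∈ D ⊎ Σ (Fin n) λ u → u ∈ D × G u v ≡ true

-- a copy of F in G - N[D]: an injective edge-preserving map V(F) → V(G)
-- whose image avoids N[D]
record CopyOutside {p n : ℕ} (F : Graph p) (G : Graph n) (D : Subset n) : Set where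
  field
    f         : Fin p → Fin n
    injective : ∀ (a b : Fin p) → f a ≡ f b → a ≡ b
    preserves : ∀ (a b : Fin p) → F a b ≡ true → G (f a) (f b) ≡ true
    avoids    : ∀ (a : Fin p) → ¬ InClosedNbhd G D (f a)

Isolating : ∀ {p n} → Graph p → Graph n → Subset n → Set
Isolating F G D = ¬ CopyOutside F G D

MinIsolating : ∀ {p n} → Graph p → Graph n → Subset n → Set
MinIsolating {p} {n} F G D =
  Isolating F G D × (∀ (D' : Subset n) → Isolating F G D' → ∣ D ∣ ≤ ∣ D' ∣)

IotaIs : ∀ {p n} → Graph n → Graph p → ℕ → Set
IotaIs {p} {n} G F k = Σ (Subset n) λ D → MinIsolating F G D × ∣ D ∣ ≡ k

deleteVertex : ∀ {n} → Graph n → Fin n → Graph (pred n)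
deleteVertex {suc n} G x = λ i j → G (punchIn x i) (punchIn x j)

plusEdge : ∀ {p} → Graph p → Fin p → Fin p → Graph p
plusEdge F a b = λ i j →
  F i j ∨ ((⌊ i ≟ a ⌋ ∧ ⌊ j ≟ b ⌋) ∨ (⌊ i ≟ b ⌋ ∧ ⌊ j ≟ a ⌋))

Isomorphic : ∀ {n p} → Graph n → Graph p → Set
Isomorphic {n} {p} G H =
  Σ (Fin n ↔ Fin p) λ φ → ∀ (u v : Fin n) → G u v ≡ H (Inverse.to φ u) (Inverse.to φ v)

IsCopyOfPlusEdge : ∀ {p n} → Graph p → Graph n → Set
IsCopyOfPlusEdge {p} F G =
  Σ (Fin p) λ a → Σ (Fin p) λ b → a ≢ b × F a b ≡ false × Isomorphic G (plusEdge F a b)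

data Walk {q : ℕ} (T : Graph q) : Fin q → Fin q → Set where
  here  : ∀ {i} → Walk T i i
  there : ∀ {i j k} → T i j ≡ true → Walk T j k → Walk T i k

Connected : ∀ {q} → Graph q → Set
Connected {q} T = ∀ (i j : Fin q) → Walk T i j

-- a cycle of length l + 3: distinct vertices c 0, …, c (l+2), consecutive
-- ones adjacent and c (l+2) adjacent to c 0
record Cycle {q : ℕ} (T : Graph q) : Set where
  field
    l         : ℕ
    c         : Fin (suc (suc (suc l))) → Fin q
    injective : ∀ i j → c i ≡ c j → i ≡ j
    steps     : ∀ (i : Fin (suc (suc l))) → T (c (inject₁ i)) (c (suc i)) ≡ true
    closing   : T (c (fromℕ (suc (suc l)))) (c zero) ≡ true

Acyclic : ∀ {q} → Graph q → Set
Acyclic T = ¬ Cycle T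

Tree : ∀ {q} → Graph q → Set
Tree T = SimpleGraph T × Connected T × Acyclic T

-- Pure (m,F)-special graphs.
-- Abstract vertex set: inj₁ i is the quotient vertex v_i, inj₂ (i , a) is the
-- vertex a of the i-th copy F_i of F.

SVertex : ℕ → ℕ → Set
SVertex q p = Fin q ⊎ (Fin q × Fin p)

specialAdj : ∀ {q p} → Graph q → Graph p → (Fin q → Fin p) →
             SVertex q p → SVertex q p → Bool
specialAdj T F w (inj₁ i)       (inj₁ j)       = T i j
specialAdj T F w (inj₁ i)       (inj₂ (j , b)) = ⌊ i ≟ j ⌋ ∧ ⌊ b ≟ w j ⌋
specialAdj T F w (inj₂ (i , a)) (inj₁ j)       = ⌊ i ≟ j ⌋ ∧ ⌊ a ≟ w i ⌋
specialAdj T F w (inj₂ (i , a)) (inj₂ (j , b)) = ⌊ i ≟ j ⌋ ∧ F a b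

record Representation {p n : ℕ} (m : ℕ) (F : Graph p) (G : Graph n) : Set where
  field
    q        : ℕ
    q≥1      : 1 ≤ q
    count    : m + 1 ≡ q * (edgeCount F + 2)
    T        : Graph q
    T-tree   : Tree T
    w        : Fin q → Fin p
    φ        : Fin n ↔ SVertex q p
    edges    : ∀ (u v : Fin n) →
               G u v ≡ specialAdj T F w (Inverse.to φ u) (Inverse.to φ v)

  quotientVertex : Fin q → Fin n
  quotientVertex i = Inverse.from φ (inj₁ i)

IsPureSpecial : ∀ {p n} → ℕ → Graph p → Graph n → Set
IsPureSpecial m F G = Representation m F G

IsQuotientVertex : ∀ {p n m} {F : Graph p} {G : Graph n} →
                   Representation m F G → Fin n → Set
IsQuotientVertex R x = Σ (Fin (Representation.q R)) λ i → Representation.quotientVertex R i ≡ x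

{-# OPTIONS --safe #-}
-- Each block {v_i} ∪ V(F_i) contains a copy of F whose closed neighbourhood stays in the
-- block, so ι(G,F) ≥ q; and x together with the quotient vertices of the other blocks is
-- F-isolating, because a copy of F lies in the closed neighbourhood of its dominating vertex,
-- where the blocked vertices leave too little room. Deleting x ∈ V(F_i) lowers ι by one: the
-- remaining quotient vertices still isolate G − x unless q = 1, and then a copy of F in G − x
-- forces, by counting degrees, x to be a leaf attached to a copy of F, i.e. the quotient
-- vertex of another representation. F + e has p vertices, so one vertex isolates it.
module Submission where

open import Defs
open import Data.Bool using (Bool; true; false; _∧_; _∨_; if_then_else_)
open import Data.Bool.Properties using (∧-zeroʳ; ∧-identityʳ; ∧-conicalˡ; ∧-conicalʳ; ⇔→≡)
import Data.Bool.Properties as Bool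
open import Data.Empty using (⊥)
open import Data.Fin using (Fin; zero; suc; punchIn; punchOut; _≟_; fromℕ<)
open import Data.Fin.Permutation using (Permutation; permutation; _⟨$⟩ʳ_; _⟨$⟩ˡ_; inverseˡ; inverseʳ)
open import Data.Fin.Properties
  using (injective⇒≤; punchOut-injective; punchIn-punchOut; punchInᵢ≢i; punchIn-injective; suc-injective; any?; ¬∀⟶∃¬)
open import Data.Fin.Subset using (Subset; _∈_; ∣_∣; inside; outside; ⁅_⁆)
open import Data.Fin.Subset.Properties using (_∈?_; x∈⁅x⁆; ∣⁅x⁆∣≡1; x∈p⇒∣p-x∣<∣p∣)
open import Data.Nat using (ℕ; zero; suc; _+_; _*_; _∸_; _≤_; _<_; z≤n; s≤s)
open import Data.Nat.Properties
  using ( ≤-refl; ≤-reflexive; ≤-trans; ≤-antisym; ≤-pred; <⇒≱; n≮n; m≤m+n; m<m+n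
        ; +-assoc; +-identityʳ; +-mono-≤; +-monoˡ-≤; +-monoʳ-≤; +-cancelˡ-≤; +-cancelʳ-≤
        ; *-monoʳ-≤; *-cancelˡ-≤; +-0-commutativeMonoid; module ≤-Reasoning)
open import Algebra.Properties.CommutativeMonoid.Sum +-0-commutativeMonoid
  using (sum; sum-remove; ∑-distrib-+; sum-permute; sum-cong-≗; sum-replicate-zero)
open import Data.Product using (Σ; ∃; ∃₂; _×_; _,_; proj₁; proj₂)
import Data.Product.Properties as Product
open import Data.Sum using (_⊎_; inj₁; inj₂; [_,_]′)
import Data.Sum
import Data.Sum.Properties as Sum
open import Data.Vec using (_∷_; tabulate; lookup; insertAt; removeAt; here; there)
open import Data.Vec.Properties
  using (lookup∘tabulate; []=⇒lookup; lookup⇒[]=; insertAt-lookup; insertAt-punchIn; removeAt-punchOut; insertAt-removeAt)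
open import Function using (_∘_; flip; id)
open import Function.Bundles using (_↔_; Inverse; mk↔ₛ′; mk⇔)
open import Function.Construct.Composition using (_↔-∘_)
open import Function.Definitions using (Injective)
open import Relation.Binary.Definitions using (DecidableEquality)
open import Relation.Binary.PropositionalEquality
open import Relation.Nullary using (¬_; ¬?; Dec; yes; no; does; contradiction)
open import Relation.Nullary.Decidable using (⌊_⌋; _⊎-dec_; _×-dec_; decidable-stable; dec-true)
open import Relation.Unary using (Pred; Decidable)

injective-avoiding⇒< : ∀ {m n} {s : Fin n} (f : Fin m → Fin n) →
                       Injective _≡_ _≡_ f → (∀ a → f a ≢ s) → m < n
injective-avoiding⇒< {n = suc n} f f-inj f≢s =
  s≤s (injective⇒≤ (λ eq → f-inj (punchOut-injective (f≢s _ ∘ sym) (f≢s _ ∘ sym) eq)))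

injective-avoiding₂⇒< : ∀ {m n} {s t : Fin n} (f : Fin m → Fin n) →
                        Injective _≡_ _≡_ f → s ≢ t →
                        (∀ a → f a ≢ s) → (∀ a → f a ≢ t) → suc m < n
injective-avoiding₂⇒< {n = suc n} {s} f f-inj s≢t f≢s f≢t =
  s≤s (injective-avoiding⇒< (λ a → punchOut (f≢s a ∘ sym))
        (λ eq → f-inj (punchOut-injective (f≢s _ ∘ sym) (f≢s _ ∘ sym) eq))
        (λ a eq → f≢t a (punchOut-injective (f≢s a ∘ sym) s≢t eq)))

injective⇒surjective : ∀ {n} (f : Fin n → Fin n) → Injective _≡_ _≡_ f → ∀ t → ∃ λ s → f s ≡ t
injective⇒surjective {suc n} f f-inj t with any? (λ s → f s ≟ t)
... | yes found = found
... | no none = contradiction (injective-avoiding⇒< f f-inj (λ s eq → none (s , eq))) (n≮n _)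

injective⇒permutation : ∀ {n} (f : Fin n → Fin n) → Injective _≡_ _≡_ f → Permutation n n
injective⇒permutation f f-inj =
  permutation f (proj₁ ∘ surj) (proj₂ ∘ surj) (λ s → f-inj (proj₂ (surj (f s))))
  where surj = injective⇒surjective f f-inj

≟-refl : ∀ {n} (i : Fin n) → ⌊ i ≟ i ⌋ ≡ true
≟-refl i with i ≟ i
... | yes _ = refl
... | no i≢i = contradiction refl i≢i

≟-sound : ∀ {n} {i j : Fin n} → ⌊ i ≟ j ⌋ ≡ true → i ≡ j
≟-sound {i = i} {j} eq with i ≟ j
... | yes i≡j = i≡j

≟-sym : ∀ {n} (i j : Fin n) → ⌊ i ≟ j ⌋ ≡ ⌊ j ≟ i ⌋
≟-sym i j with i ≟ j | j ≟ i
... | yes _ | yes _ = refl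
... | no _ | no _ = refl
... | yes i≡j | no j≢i = contradiction (sym i≡j) j≢i
... | no i≢j | yes j≡i = contradiction (sym j≡i) i≢j

subset : ∀ {n ℓ} {P : Pred (Fin n) ℓ} → Decidable P → Subset n
subset P? = tabulate (λ u → does (P? u))

module _ {n ℓ} {P : Pred (Fin n) ℓ} (P? : Decidable P) where

  ∈-subset⁺ : ∀ {u} → P u → u ∈ subset P?
  ∈-subset⁺ {u} Pu = lookup⇒[]= u _ (trans (lookup∘tabulate _ u) (dec-true (P? u) Pu))

  ∈-subset⁻ : ∀ {u} → u ∈ subset P? → P u
  ∈-subset⁻ {u} u∈ = true⇒P (P? u) (trans (sym (lookup∘tabulate _ u)) ([]=⇒lookup u∈))
    where true⇒P : ∀ d → does d ≡ true → P u
          true⇒P (yes Pu) _ = Pu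

member : ∀ {n} (D : Subset n) → Fin ∣ D ∣ → Fin n
member (inside ∷ D) zero = zero
member (inside ∷ D) (suc r) = suc (member D r)
member (outside ∷ D) r = suc (member D r)

member-∈ : ∀ {n} (D : Subset n) r → member D r ∈ D
member-∈ (inside ∷ D) zero = here
member-∈ (inside ∷ D) (suc r) = there (member-∈ D r)
member-∈ (outside ∷ D) r = there (member-∈ D r)

member-injective : ∀ {n} (D : Subset n) → Injective _≡_ _≡_ (member D)
member-injective (inside ∷ D) {zero} {zero} _ = refl
member-injective (inside ∷ D) {suc r} {suc r′} eq = cong suc (member-injective D (suc-injective eq))
member-injective (outside ∷ D) eq = member-injective D (suc-injective eq)

position : ∀ {n} (D : Subset n) {u} → u ∈ D → Fin ∣ D ∣
position (inside ∷ D) here = zero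
position (inside ∷ D) (there u∈D) = suc (position D u∈D)
position (outside ∷ D) (there u∈D) = position D u∈D

position-injective : ∀ {n} (D : Subset n) {u v} (u∈D : u ∈ D) (v∈D : v ∈ D) →
                     position D u∈D ≡ position D v∈D → u ≡ v
position-injective (inside ∷ D) here here _ = refl
position-injective (inside ∷ D) (there u∈D) (there v∈D) eq =
  cong suc (position-injective D u∈D v∈D (suc-injective eq))
position-injective (outside ∷ D) (there u∈D) (there v∈D) eq =
  cong suc (position-injective D u∈D v∈D eq)

∣∣≤-injectiveOn : ∀ {n m} (D : Subset n) (g : Fin n → Fin m) →
                  (∀ {u v} → u ∈ D → v ∈ D → g u ≡ g v → u ≡ v) → ∣ D ∣ ≤ m
∣∣≤-injectiveOn D g g-inj =
  injective⇒≤ (λ eq → member-injective D (g-inj (member-∈ D _) (member-∈ D _) eq))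

≤∣∣-injection : ∀ {n m} (D : Subset n) (h : Fin m → Fin n) →
                Injective _≡_ _≡_ h → (∀ i → h i ∈ D) → m ≤ ∣ D ∣
≤∣∣-injection D h h-inj h∈D =
  injective⇒≤ (λ eq → h-inj (position-injective D (h∈D _) (h∈D _) eq))

nonempty⇒1≤∣∣ : ∀ {n} {D : Subset n} {u} → u ∈ D → 1 ≤ ∣ D ∣
nonempty⇒1≤∣∣ u∈D = ≤-trans (s≤s z≤n) (x∈p⇒∣p-x∣<∣p∣ u∈D)

∣insertAt-inside∣ : ∀ {n} (D : Subset n) i → ∣ insertAt D i inside ∣ ≡ suc ∣ D ∣
∣insertAt-inside∣ D zero = refl
∣insertAt-inside∣ (inside ∷ D) (suc i) = cong suc (∣insertAt-inside∣ D i)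
∣insertAt-inside∣ (outside ∷ D) (suc i) = ∣insertAt-inside∣ D i

∈-insertAt-removeAt : ∀ {n} {D : Subset (suc n)} {x u} b → x ≢ u → u ∈ D → u ∈ insertAt (removeAt D x) x b
∈-insertAt-removeAt {D = D} {x} {u} b x≢u u∈D = lookup⇒[]= u _ (begin
  lookup (insertAt (removeAt D x) x b) u                          ≡⟨ cong (lookup (insertAt (removeAt D x) x b)) (punchIn-punchOut x≢u) ⟨
  lookup (insertAt (removeAt D x) x b) (punchIn x (punchOut x≢u)) ≡⟨ insertAt-punchIn (removeAt D x) x b _ ⟩
  lookup (removeAt D x) (punchOut x≢u)                            ≡⟨ removeAt-punchOut D x≢u ⟩
  lookup D u                                                      ≡⟨ []=⇒lookup u∈D ⟩
  inside                                                          ∎)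
  where open ≡-Reasoning

∑-mono-≤ : ∀ {n} {f g : Fin n → ℕ} → (∀ i → f i ≤ g i) → sum f ≤ sum g
∑-mono-≤ {zero} f≤g = z≤n
∑-mono-≤ {suc n} f≤g = +-mono-≤ (f≤g zero) (∑-mono-≤ (f≤g ∘ suc))

∑-mono-≤-tight : ∀ {n} {f g : Fin n → ℕ} → (∀ i → f i ≤ g i) → sum g ≤ sum f → ∀ i → f i ≡ g i
∑-mono-≤-tight {suc n} {f} {g} f≤g ∑g≤∑f = pointwise
  where
    head-eq : f zero ≡ g zero
    head-eq = ≤-antisym (f≤g zero)
      (+-cancelʳ-≤ _ _ _ (≤-trans ∑g≤∑f (+-monoʳ-≤ (f zero) (∑-mono-≤ (f≤g ∘ suc)))))
    tail-≤ : sum (g ∘ suc) ≤ sum (f ∘ suc)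
    tail-≤ = +-cancelˡ-≤ (g zero) _ _ (subst (λ x → g zero + _ ≤ x + _) head-eq ∑g≤∑f)
    pointwise : ∀ i → f i ≡ g i
    pointwise zero = head-eq
    pointwise (suc i) = ∑-mono-≤-tight (f≤g ∘ suc) tail-≤ i

≤-∑ : ∀ {n} (f : Fin n → ℕ) i → f i ≤ sum f
≤-∑ {suc n} f i = ≤-trans (m≤m+n (f i) _) (≤-reflexive (sym (sum-remove f)))

∑-supportedAt : ∀ {n} (f : Fin (suc n) → ℕ) i → (∀ j → f (punchIn i j) ≡ 0) → sum f ≡ f i
∑-supportedAt {n} f i zero-elsewhere = begin
  sum f                         ≡⟨ sum-remove f ⟩
  f i + sum (f ∘ punchIn i)     ≡⟨ cong (f i +_) (trans (sum-cong-≗ zero-elsewhere) (sum-replicate-zero n)) ⟩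
  f i + 0                       ≡⟨ +-identityʳ (f i) ⟩
  f i                           ∎
  where open ≡-Reasoning

EdgePreserving : ∀ {A B : Set} → (A → A → Bool) → (B → B → Bool) → (A → B) → Set
EdgePreserving E E′ f = ∀ a b → E a b ≡ true → E′ (f a) (f b) ≡ true

_⊆ᴳ_ : ∀ {p} → Graph p → Graph p → Set
A ⊆ᴳ B = EdgePreserving A B id

indicator : Bool → ℕ
indicator b = if b then 1 else 0

indicator-mono : ∀ {a b} → (a ≡ true → b ≡ true) → indicator a ≤ indicator b
indicator-mono {false} _ = z≤n
indicator-mono {true} a⇒b rewrite a⇒b refl = ≤-refl

indicator-injective : ∀ {a b} → indicator a ≡ indicator b → a ≡ b
indicator-injective {false} {false} _ = refl
indicator-injective {true} {true} _ = refl

degree : ∀ {p} → Graph p → Fin p → ℕ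
degree A s = sum (λ t → indicator (A s t))

degreeSum : ∀ {p} → Graph p → ℕ
degreeSum A = sum (degree A)

degreeSum-mono : ∀ {p} {A B : Graph p} → A ⊆ᴳ B → degreeSum A ≤ degreeSum B
degreeSum-mono A⊆B = ∑-mono-≤ (λ s → ∑-mono-≤ (λ t → indicator-mono (A⊆B s t)))

degreeSum-tight : ∀ {p} {A B : Graph p} → A ⊆ᴳ B → degreeSum B ≤ degreeSum A → B ⊆ᴳ A
degreeSum-tight {A = A} {B} A⊆B ∑B≤∑A s t Bst = trans (indicator-injective same) Bst
  where
    rows-≤ : ∀ s → degree A s ≤ degree B s
    rows-≤ s = ∑-mono-≤ (λ t → indicator-mono (A⊆B s t))
    same : indicator (A s t) ≡ indicator (B s t)
    same = ∑-mono-≤-tight (λ t → indicator-mono (A⊆B s t))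
             (≤-reflexive (sym (∑-mono-≤-tight rows-≤ ∑B≤∑A s))) t

degreeSum-permute : ∀ {p} (A : Graph p) (π : Permutation p p) →
                    degreeSum (λ s t → A (π ⟨$⟩ʳ s) (π ⟨$⟩ʳ t)) ≡ degreeSum A
degreeSum-permute A π = begin
  sum (λ s → degree A′ s)           ≡⟨ sum-cong-≗ (λ s → sym (sum-permute (λ t → indicator (A (π ⟨$⟩ʳ s) t)) π)) ⟩
  sum (λ s → degree A (π ⟨$⟩ʳ s))   ≡⟨ sym (sum-permute (degree A) π) ⟩
  degreeSum A                       ∎
  where
    open ≡-Reasoning
    A′ = λ s t → A (π ⟨$⟩ʳ s) (π ⟨$⟩ʳ t)

degreeSum-split : ∀ {p} (A : Graph (suc p)) → SimpleGraph A → ∀ a →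
                  degreeSum A ≡ 2 * degree A a + degreeSum (λ s t → A (punchIn a s) (punchIn a t))
degreeSum-split A (A-sym , A-loopless) a = begin
  degreeSum A                                       ≡⟨ sum-remove (degree A) ⟩
  d + sum (λ s → degree A (punchIn a s))            ≡⟨ cong (d +_) (sum-cong-≗ (λ s → sum-remove {i = a} (λ t → indicator (A (punchIn a s) t)))) ⟩
  d + sum (λ s → indicator (A (punchIn a s) a) + degree A∖a s)
                                                    ≡⟨ cong (d +_) (∑-distrib-+ (λ s → indicator (A (punchIn a s) a)) (degree A∖a)) ⟩
  d + (sum (λ s → indicator (A (punchIn a s) a)) + r) ≡⟨ cong (λ x → d + (x + r)) column ⟩
  d + (d + r)                                       ≡⟨ sym (+-assoc d d r) ⟩
  d + d + r                                         ≡⟨ cong (λ x → d + x + r) (+-identityʳ d) ⟨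
  2 * d + r                                         ∎
  where
    open ≡-Reasoning
    A∖a = λ s t → A (punchIn a s) (punchIn a t)
    d = degree A a
    r = degreeSum A∖a
    column : sum (λ s → indicator (A (punchIn a s) a)) ≡ d
    column = begin
      sum (λ s → indicator (A (punchIn a s) a))     ≡⟨ sum-cong-≗ (λ s → cong indicator (A-sym (punchIn a s) a)) ⟩
      sum (λ s → indicator (A a (punchIn a s)))     ≡⟨ cong (λ b → indicator b + sum (λ s → indicator (A a (punchIn a s)))) (A-loopless a) ⟨
      indicator (A a a) + sum (λ s → indicator (A a (punchIn a s))) ≡⟨ sum-remove (λ t → indicator (A a t)) ⟨
      d                                             ∎

degree≡0 : ∀ {p} (A : Graph p) s → (∀ t → A s t ≡ false) → degree A s ≡ 0
degree≡0 {p} A s no-nbr = trans (sum-cong-≗ (λ t → cong indicator (no-nbr t))) (sum-replicate-zero p)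

degree≤1 : ∀ {p} (A : Graph (suc p)) s t₀ → (∀ t → A s t ≡ true → t ≡ t₀) → degree A s ≤ 1
degree≤1 A s t₀ only-t₀ = ≤-trans (≤-reflexive (∑-supportedAt (λ t → indicator (A s t)) t₀ elsewhere))
                                  (indicator-mono {A s t₀} {true} (λ _ → refl))
  where
    elsewhere : ∀ j → indicator (A s (punchIn t₀ j)) ≡ 0
    elsewhere j with A s (punchIn t₀ j) in eq
    ... | false = refl
    ... | true = contradiction (only-t₀ _ eq) (punchInᵢ≢i t₀ j)

1≤degree : ∀ {p} (A : Graph (suc p)) s t → A s t ≡ true → 1 ≤ degree A s
1≤degree A s t Ast = ≤-trans (≤-reflexive (cong indicator (sym Ast))) (≤-∑ (λ t → indicator (A s t)) t)

degree≤1⇒unique : ∀ {p} (A : Graph (suc p)) s t t′ → degree A s ≤ 1 →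
                  A s t ≡ true → A s t′ ≡ true → t ≡ t′
degree≤1⇒unique A s t t′ deg≤1 Ast Ast′ with t ≟ t′
... | yes t≡t′ = t≡t′
... | no t≢t′ = contradiction deg≤1 (<⇒≱ (begin-strict
  1                                                         ≡⟨ cong indicator (sym Ast) ⟩
  indicator (A s t)                                         <⟨ m<m+n (indicator (A s t)) t′-counted ⟩
  indicator (A s t) + sum (λ j → indicator (A s (punchIn t j))) ≡⟨ sym (sum-remove {i = t} (λ t → indicator (A s t))) ⟩
  degree A s                                                ∎))
  where
    open ≤-Reasoning
    t′-counted : 1 ≤ sum (λ j → indicator (A s (punchIn t j)))
    t′-counted = ≤-trans (≤-reflexive (cong indicator (sym (trans (cong (A s) (punchIn-punchOut t≢t′)) Ast′))))
                         (≤-∑ _ (punchOut t≢t′))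

module VertexModification {p} {A B : Graph (suc p)} (A-simple : SimpleGraph A) (B-simple : SimpleGraph B)
       (a : Fin (suc p)) (agree : ∀ s t → A (punchIn a s) (punchIn a t) ≡ B (punchIn a s) (punchIn a t))
       (π : Permutation (suc p) (suc p)) (A⊆Bπ : EdgePreserving A B (π ⟨$⟩ʳ_)) where

  private
    rest : ℕ
    rest = degreeSum (λ s t → B (punchIn a s) (punchIn a t))

    degreeSum-A : degreeSum A ≡ 2 * degree A a + rest
    degreeSum-A = trans (degreeSum-split A A-simple a)
                        (cong (2 * degree A a +_) (sum-cong-≗ (λ s → sum-cong-≗ (λ t → cong indicator (agree s t)))))

    degreeSum-B : degreeSum B ≡ 2 * degree B a + rest
    degreeSum-B = degreeSum-split B B-simple a

  degree-mono : degree A a ≤ degree B a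
  degree-mono = *-cancelˡ-≤ 2 (+-cancelʳ-≤ rest _ _ (begin
    2 * degree A a + rest                         ≡⟨ degreeSum-A ⟨
    degreeSum A                                   ≤⟨ degreeSum-mono A⊆Bπ ⟩
    degreeSum (λ s t → B (π ⟨$⟩ʳ s) (π ⟨$⟩ʳ t))   ≡⟨ degreeSum-permute B π ⟩
    degreeSum B                                   ≡⟨ degreeSum-B ⟩
    2 * degree B a + rest                         ∎))
    where open ≤-Reasoning

  reflects : degree B a ≤ degree A a → (λ s t → B (π ⟨$⟩ʳ s) (π ⟨$⟩ʳ t)) ⊆ᴳ A
  reflects B≤A = degreeSum-tight A⊆Bπ (begin
    degreeSum (λ s t → B (π ⟨$⟩ʳ s) (π ⟨$⟩ʳ t))   ≡⟨ degreeSum-permute B π ⟩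
    degreeSum B                                   ≡⟨ degreeSum-B ⟩
    2 * degree B a + rest                         ≤⟨ +-monoˡ-≤ rest (*-monoʳ-≤ 2 B≤A) ⟩
    2 * degree A a + rest                         ≡⟨ degreeSum-A ⟨
    degreeSum A                                   ∎)
    where open ≤-Reasoning

edge⇒≢ : ∀ {p} {F : Graph p} → SimpleGraph F → ∀ {a b} → F a b ≡ true → a ≢ b
edge⇒≢ (_ , F-loopless) {a} Fab refl = contradiction (trans (sym Fab) (F-loopless a)) λ ()

3≤edgeCount⇒3≤p : ∀ {p} (F : Graph p) → 3 ≤ edgeCount F → 3 ≤ p
3≤edgeCount⇒3≤p {1} F h rewrite ∧-zeroʳ (F zero zero) with () ← h
3≤edgeCount⇒3≤p {2} F h rewrite ∧-zeroʳ (F zero zero) | ∧-identityʳ (F zero (suc zero))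
                              | ∧-zeroʳ (F (suc zero) zero) | ∧-zeroʳ (F (suc zero) (suc zero))
                              with F zero (suc zero) | h
... | false | ()
... | true | s≤s ()
3≤edgeCount⇒3≤p {suc (suc (suc p))} F _ = s≤s (s≤s (s≤s z≤n))

two-others : ∀ {p} → 3 ≤ p → (c : Fin p) → ∃₂ λ b₁ b₂ → b₁ ≢ c × b₂ ≢ c × b₁ ≢ b₂
two-others {1} (s≤s ()) _
two-others {2} (s≤s (s≤s ())) _
two-others {suc (suc (suc p))} _ c =
  punchIn c zero , punchIn c (suc zero) , punchInᵢ≢i c zero , punchInᵢ≢i c (suc zero) ,
  (λ eq → contradiction (punchIn-injective c zero (suc zero) eq) λ ())

dominated⇒neighbour : ∀ {p} {F : Graph p} → SimpleGraph F → DominationNumberOne F → 3 ≤ p →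
                      ∀ a → ∃ λ b → F a b ≡ true
dominated⇒neighbour (F-sym , _) (c , c-dom) 3≤p a with a ≟ c
... | no a≢c = c , trans (F-sym a c) (c-dom a a≢c)
... | yes refl = let b , _ , b≢c , _ = two-others 3≤p c in b , c-dom b b≢c

walk-first-step : ∀ {q} {T : Graph q} {i j} → Walk T i j → i ≢ j → ∃ λ k → T i k ≡ true
walk-first-step here i≢i = contradiction refl i≢i
walk-first-step (there {j = k} Tik _) _ = k , Tik

inClosedNbhd? : ∀ {n} (G : Graph n) (D : Subset n) v → Dec (InClosedNbhd G D v)
inClosedNbhd? G D v = (v ∈? D) ⊎-dec any? (λ u → (u ∈? D) ×-dec (G u v Bool.≟ true))

module _ {p n} {F : Graph p} {G : Graph n} where

  copyOutside : ∀ {D} (f : Fin p → Fin n) → Injective _≡_ _≡_ f → EdgePreserving F G f →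
                (∀ a → ¬ InClosedNbhd G D (f a)) → CopyOutside F G D
  copyOutside f f-inj f-hom f-avoids = record
    { f = f ; injective = λ _ _ → f-inj ; preserves = f-hom ; avoids = f-avoids }

  isolating⇒meets : ∀ {D} → Isolating F G D → (f : Fin p → Fin n) → Injective _≡_ _≡_ f →
                    EdgePreserving F G f → ∃ λ a → InClosedNbhd G D (f a)
  isolating⇒meets {D} isolating f f-inj f-hom =
    let a , ¬¬meets = ¬∀⟶∃¬ p (λ a → ¬ InClosedNbhd G D (f a)) (λ a → ¬? (inClosedNbhd? G D (f a)))
                        (isolating ∘ copyOutside f f-inj f-hom)
    in a , decidable-stable (inClosedNbhd? G D (f a)) ¬¬meets

module _ {p n} {F : Graph p} {G : Graph (suc n)} (x : Fin (suc n)) where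

  private
    punchIn-∈ : ∀ {D′ : Subset n} {b u} → u ∈ D′ → punchIn x u ∈ insertAt D′ x b
    punchIn-∈ {D′} {b} {u} u∈D′ = lookup⇒[]= _ _ (trans (insertAt-punchIn D′ x b u) ([]=⇒lookup u∈D′))

    punchIn-∈⁻ : ∀ {D′ : Subset n} {b u} → punchIn x u ∈ insertAt D′ x b → u ∈ D′
    punchIn-∈⁻ {D′} {b} {u} u∈ = lookup⇒[]= _ _ (trans (sym (insertAt-punchIn D′ x b u)) ([]=⇒lookup u∈))

  isolating-insertAt : ∀ {D′} → Isolating F (deleteVertex G x) D′ → Isolating F G (insertAt D′ x inside)
  isolating-insertAt {D′} isolating C = isolating (copyOutside f′ f′-inj f′-hom f′-avoids)
    where
      open CopyOutside C
      x∈D⁺ : x ∈ insertAt D′ x inside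
      x∈D⁺ = lookup⇒[]= x _ (insertAt-lookup D′ x inside)
      x≢f : ∀ a → x ≢ f a
      x≢f a x≡fa = avoids a (inj₁ (subst (_∈ _) x≡fa x∈D⁺))
      f′ : Fin p → Fin n
      f′ a = punchOut (x≢f a)
      punchIn-f′ : ∀ a → punchIn x (f′ a) ≡ f a
      punchIn-f′ a = punchIn-punchOut (x≢f a)
      f′-inj : Injective _≡_ _≡_ f′
      f′-inj eq = injective _ _ (trans (sym (punchIn-f′ _)) (trans (cong (punchIn x) eq) (punchIn-f′ _)))
      f′-hom : EdgePreserving F (deleteVertex G x) f′
      f′-hom a b Fab = subst₂ (λ u v → G u v ≡ true) (sym (punchIn-f′ a)) (sym (punchIn-f′ b)) (preserves a b Fab)
      f′-avoids : ∀ a → ¬ InClosedNbhd (deleteVertex G x) D′ (f′ a)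
      f′-avoids a (inj₁ f′a∈D′) = avoids a (inj₁ (subst (_∈ _) (punchIn-f′ a) (punchIn-∈ f′a∈D′)))
      f′-avoids a (inj₂ (d , d∈D′ , adj)) = avoids a (inj₂ (punchIn x d , punchIn-∈ d∈D′ , subst (λ v → G _ v ≡ true) (punchIn-f′ a) adj))

  copy-in-deletion : ∀ {D′} (C : CopyOutside F (deleteVertex G x) D′) → let open CopyOutside C in
                     ∀ a → ¬ (punchIn x (f a) ≡ x ⊎ InClosedNbhd G (insertAt D′ x outside) (punchIn x (f a)))
  copy-in-deletion C a (inj₁ hits-x) = punchInᵢ≢i x _ hits-x
  copy-in-deletion C a (inj₂ (inj₁ fa∈D)) = CopyOutside.avoids C a (inj₁ (punchIn-∈⁻ fa∈D))
  copy-in-deletion {D′} C a (inj₂ (inj₂ (d , d∈D , adj))) with x ≟ d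
  ... | yes refl = contradiction (trans (sym ([]=⇒lookup d∈D)) (insertAt-lookup D′ x outside)) λ ()
  ... | no x≢d = CopyOutside.avoids C a (inj₂ (punchOut x≢d , punchIn-∈⁻ (subst (_∈ _) (sym (punchIn-punchOut x≢d)) d∈D)
                                              , subst (λ u → G u _ ≡ true) (sym (punchIn-punchOut x≢d)) adj))

index : ∀ {q p} → SVertex q p → Fin q
index (inj₁ i) = i
index (inj₂ (i , _)) = i

block : ∀ {q p} → Fin q → Fin (suc p) → SVertex q p
block j zero = inj₁ j
block j (suc a) = inj₂ (j , a)

_≟ᵥ_ : ∀ {q p} → DecidableEquality (SVertex q p)
_≟ᵥ_ = Sum.≡-dec _≟_ (Product.≡-dec _≟_ _≟_)

representative : ∀ {q p} → SVertex q p → Fin q → SVertex q p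
representative X j with j ≟ index X
... | yes _ = X
... | no _ = inj₁ j

index-representative : ∀ {q p} (X : SVertex q p) j → index (representative X j) ≡ j
index-representative X j with j ≟ index X
... | yes j≡iX = sym j≡iX
... | no _ = refl

representative-self : ∀ {q p} (X : SVertex q p) → representative X (index X) ≡ X
representative-self X with index X ≟ index X
... | yes _ = refl
... | no i≢i = contradiction refl i≢i

representative-other : ∀ {q p} (X : SVertex q p) j → j ≢ index X → representative X j ≡ inj₁ j
representative-other X j j≢iX with j ≟ index X
... | yes j≡iX = contradiction j≡iX j≢iX
... | no _ = refl

module SpecialAdjacency {q p} {F : Graph p} (T : Graph q) (w : Fin q → Fin p) where

  S : SVertex q p → SVertex q p → Bool
  S = specialAdj T F w

  quotient-neighbour : ∀ j Y → S (inj₁ j) Y ≡ true →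
                       (∃ λ l → Y ≡ inj₁ l × T j l ≡ true) ⊎ Y ≡ inj₂ (j , w j)
  quotient-neighbour j (inj₁ l) Tjl = inj₁ (l , refl , Tjl)
  quotient-neighbour j (inj₂ (l , b)) adj
    with refl ← ≟-sound {i = j} (∧-conicalˡ _ _ adj) | refl ← ≟-sound {i = b} (∧-conicalʳ _ _ adj) = inj₂ refl

  copy-neighbour : ∀ j a Y → S (inj₂ (j , a)) Y ≡ true → ∃ λ s → Y ≡ block j s
  copy-neighbour j a (inj₁ l) adj with refl ← ≟-sound {i = j} (∧-conicalˡ _ _ adj) = zero , refl
  copy-neighbour j a (inj₂ (l , b)) adj with refl ← ≟-sound {i = j} (∧-conicalˡ _ _ adj) = suc b , refl

  copy-neighbour-index : ∀ Y j a → S Y (inj₂ (j , a)) ≡ true → index Y ≡ j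
  copy-neighbour-index (inj₁ i) j a adj = ≟-sound (∧-conicalˡ _ _ adj)
  copy-neighbour-index (inj₂ (i , _)) j a adj = ≟-sound (∧-conicalˡ _ _ adj)

  copy-edge : ∀ j a b → S (inj₂ (j , a)) (inj₂ (j , b)) ≡ F a b
  copy-edge j a b rewrite ≟-refl j = refl

  attachment-edge : ∀ j → S (inj₁ j) (inj₂ (j , w j)) ≡ true
  attachment-edge j rewrite ≟-refl j | ≟-refl (w j) = refl

  S-symmetric : SimpleGraph T → SimpleGraph F → ∀ X Y → S X Y ≡ S Y X
  S-symmetric (T-sym , _) _ (inj₁ i) (inj₁ j) = T-sym i j
  S-symmetric _ _ (inj₁ i) (inj₂ (j , b)) = cong (_∧ ⌊ b ≟ w j ⌋) (≟-sym i j)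
  S-symmetric _ _ (inj₂ (i , a)) (inj₁ j) = cong (_∧ ⌊ a ≟ w i ⌋) (≟-sym i j)
  S-symmetric _ (F-sym , _) (inj₂ (i , a)) (inj₂ (j , b)) = cong₂ _∧_ (≟-sym i j) (F-sym a b)

  S-loopless : SimpleGraph T → SimpleGraph F → ∀ X → S X X ≡ false
  S-loopless (_ , T-loopless) _ (inj₁ i) = T-loopless i
  S-loopless _ (_ , F-loopless) (inj₂ (i , a)) rewrite ≟-refl i = F-loopless a

  QuotientGuarded : (SVertex q p → Set) → Fin q → Set
  QuotientGuarded B j = B (inj₁ j) ⊎ (∀ l → T j l ≡ true → B (inj₁ l))

  BlockGuarded : (SVertex q p → Set) → Fin q → Set
  BlockGuarded B j = ∃₂ λ s t → s ≢ t × B (block j s) × B (block j t)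

  -- The copy lies in N[g c]: next to a quotient vertex only the attachment vertex can be
  -- free, which leaves no room for the p − 1 ≥ 2 other vertices; inside a block, two of
  -- the p + 1 vertices are blocked.
  no-embedding-avoiding : DominationNumberOne F → 3 ≤ p → (B : SVertex q p → Set) →
    (∀ j → BlockGuarded B j) → (∀ j → QuotientGuarded B j) →
    (g : Fin p → SVertex q p) → Injective _≡_ _≡_ g → EdgePreserving F S g → (∀ a → ¬ B (g a)) → ⊥
  no-embedding-avoiding (c , c-dom) 3≤p B block-guarded quotient-guarded g g-inj g-hom g-avoids =
    centre (g c) refl
    where
      centre-adj : ∀ a → a ≢ c → S (g c) (g a) ≡ true
      centre-adj a a≢c = g-hom c a (c-dom a a≢c)

      centre : ∀ Y → g c ≡ Y → ⊥
      centre (inj₁ j) gc≡vj with quotient-guarded j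
      ... | inj₁ Bvj = g-avoids c (subst B (sym gc≡vj) Bvj)
      ... | inj₂ neighbours-blocked =
        let b₁ , b₂ , b₁≢c , b₂≢c , b₁≢b₂ = two-others 3≤p c
        in b₁≢b₂ (g-inj (trans (onto-attachment b₁ b₁≢c) (sym (onto-attachment b₂ b₂≢c))))
        where
          onto-attachment : ∀ a → a ≢ c → g a ≡ inj₂ (j , w j)
          onto-attachment a a≢c with quotient-neighbour j (g a) (subst (λ Y → S Y (g a) ≡ true) gc≡vj (centre-adj a a≢c))
          ... | inj₁ (l , ga≡vl , Tjl) = contradiction (subst B (sym ga≡vl) (neighbours-blocked l Tjl)) (g-avoids a)
          ... | inj₂ ga≡wj = ga≡wj
      centre (inj₂ (j , b)) gc≡ =
        let s , t , s≢t , Bs , Bt = block-guarded j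
        in n≮n (suc p) (injective-avoiding₂⇒< slot slot-inj s≢t (misses Bs) (misses Bt))
        where
          in-block : ∀ a → ∃ λ s → g a ≡ block j s
          in-block a with a ≟ c
          ... | yes refl = suc b , gc≡
          ... | no a≢c = copy-neighbour j b (g a) (subst (λ Y → S Y (g a) ≡ true) gc≡ (centre-adj a a≢c))
          slot : Fin p → Fin (suc p)
          slot a = proj₁ (in-block a)
          slot-inj : Injective _≡_ _≡_ slot
          slot-inj {a} {a′} eq = g-inj (trans (proj₂ (in-block a)) (trans (cong (block j) eq) (sym (proj₂ (in-block a′)))))
          misses : ∀ {s} → B (block j s) → ∀ a → slot a ≢ s
          misses Bs a refl = g-avoids a (subst B (sym (proj₂ (in-block a))) Bs)

module PureSpecial {p n m} {F : Graph p} {G : Graph n} (F-simple : SimpleGraph F)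
                   (dom : DominationNumberOne F) (3≤p : 3 ≤ p) (R : Representation m F G) where

  open Representation R public
  open SpecialAdjacency {F = F} T w public

  to : Fin n → SVertex q p
  to = Inverse.to φ

  from : SVertex q p → Fin n
  from = Inverse.from φ

  from-to : ∀ u → from (to u) ≡ u
  from-to = Inverse.strictlyInverseʳ φ

  to-from : ∀ Y → to (from Y) ≡ Y
  to-from = Inverse.strictlyInverseˡ φ

  to-injective : Injective _≡_ _≡_ to
  to-injective eq = trans (sym (from-to _)) (trans (cong from eq) (from-to _))

  from-edge : ∀ Y Z → S Y Z ≡ true → G (from Y) (from Z) ≡ true
  from-edge Y Z adj = trans (edges (from Y) (from Z)) (subst₂ (λ Y′ Z′ → S Y′ Z′ ≡ true) (sym (to-from Y)) (sym (to-from Z)) adj)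

  quotientVertex-or-copyVertex : ∀ x → IsQuotientVertex R x ⊎ ∃₂ λ i a → to x ≡ inj₂ (i , a)
  quotientVertex-or-copyVertex x with to x in x-at
  ... | inj₁ i = inj₁ (i , trans (cong from (sym x-at)) (from-to x))
  ... | inj₂ (i , a) = inj₂ (i , a , refl)

  to-edge : ∀ {u v} → G u v ≡ true → S (to u) (to v) ≡ true
  to-edge {u} {v} adj = trans (sym (edges u v)) adj

  no-copy-avoiding : (B : Fin n → Set) → (∀ j → BlockGuarded (B ∘ from) j) → (∀ j → QuotientGuarded (B ∘ from) j) →
                     (f : Fin p → Fin n) → Injective _≡_ _≡_ f → EdgePreserving F G f → (∀ a → ¬ B (f a)) → ⊥
  no-copy-avoiding B block-guarded quotient-guarded f f-inj f-hom f-avoids =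
    no-embedding-avoiding dom 3≤p (B ∘ from) block-guarded quotient-guarded (to ∘ f) (f-inj ∘ to-injective)
      (λ a b → to-edge ∘ f-hom a b)
      (λ a → f-avoids a ∘ subst B (from-to (f a)))

  copyAt : Fin q → Fin p → Fin n
  copyAt j a = from (inj₂ (j , a))

  copyAt-injective : ∀ j → Injective _≡_ _≡_ (copyAt j)
  copyAt-injective j eq with refl ← trans (sym (to-from _)) (trans (cong to eq) (to-from _)) = refl

  copyAt-edge : ∀ j → EdgePreserving F G (copyAt j)
  copyAt-edge j a b Fab = from-edge _ _ (trans (copy-edge j a b) Fab)

  isolating⇒q≤∣∣ : ∀ {D} → Isolating F G D → q ≤ ∣ D ∣
  isolating⇒q≤∣∣ {D} isolating =
    ≤∣∣-injection D (proj₁ ∘ guard) (λ {j} {j′} eq → trans (sym (guard-index j)) (trans (cong (index ∘ to) eq) (guard-index j′)))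
                  (proj₁ ∘ proj₂ ∘ guard)
    where
      guard : ∀ j → ∃ λ d → d ∈ D × index (to d) ≡ j
      guard j with isolating⇒meets isolating (copyAt j) (copyAt-injective j) (copyAt-edge j)
      ... | a , inj₁ copy∈D = copyAt j a , copy∈D , cong index (to-from _)
      ... | a , inj₂ (d , d∈D , adj) =
        d , d∈D , copy-neighbour-index (to d) j a (subst (λ Y → S (to d) Y ≡ true) (to-from _) (to-edge adj))
      guard-index : ∀ j → index (to (proj₁ (guard j))) ≡ j
      guard-index j = proj₂ (proj₂ (guard j))

  tree-edge⇒≢ : ∀ {i l} → T i l ≡ true → l ≢ i
  tree-edge⇒≢ {i} Til refl = contradiction (trans (sym Til) (proj₂ (proj₁ T-tree) i)) λ ()

  representative? : ∀ X u → Dec (to u ≡ representative X (index (to u)))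
  representative? X u = to u ≟ᵥ representative X (index (to u))

  -- X in its own block and the quotient vertex in every other block.
  transversal : SVertex q p → Subset n
  transversal X = subset (representative? X)

  ∈-transversal : ∀ X j → from (representative X j) ∈ transversal X
  ∈-transversal X j = ∈-subset⁺ (representative? X) (trans (to-from _)
    (cong (representative X) (sym (trans (cong index (to-from _)) (index-representative X j)))))

  from-∈-transversal : ∀ X → from X ∈ transversal X
  from-∈-transversal X = subst (λ Y → from Y ∈ transversal X) (representative-self X) (∈-transversal X (index X))

  quotientVertex-∈-transversal : ∀ X l → l ≢ index X → quotientVertex l ∈ transversal X
  quotientVertex-∈-transversal X l l≢ = subst (λ Y → from Y ∈ transversal X) (representative-other X l l≢) (∈-transversal X l)

  ∣transversal∣≤q : ∀ X → ∣ transversal X ∣ ≤ q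
  ∣transversal∣≤q X = ∣∣≤-injectiveOn (transversal X) (index ∘ to) λ u∈ v∈ eq →
    to-injective (trans (∈-subset⁻ (representative? X) u∈) (trans (cong (representative X) eq) (sym (∈-subset⁻ (representative? X) v∈))))

  Blocked : Subset n → SVertex q p → Set
  Blocked D = InClosedNbhd G D ∘ from

  Guarded : (SVertex q p → Set) → Fin q → Set
  Guarded B j = BlockGuarded B j × QuotientGuarded B j

  Guarded-map : ∀ {B B′ : SVertex q p → Set} → (∀ {Y} → B Y → B′ Y) → ∀ {j} → Guarded B j → Guarded B′ j
  Guarded-map B⇒B′ ((s , t , s≢t , Bs , Bt) , guard) =
    (s , t , s≢t , B⇒B′ Bs , B⇒B′ Bt) , Data.Sum.map B⇒B′ (λ nbrs l Tjl → B⇒B′ (nbrs l Tjl)) guard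

  guarded-by-quotient : ∀ {D} j → quotientVertex j ∈ D → Guarded (Blocked D) j
  guarded-by-quotient j vj∈D =
    (zero , suc (w j) , (λ ()) , inj₁ vj∈D , inj₂ (quotientVertex j , vj∈D , from-edge _ _ (attachment-edge j))) ,
    inj₁ (inj₁ vj∈D)

  guarded-at : ∀ {D} X → from X ∈ D → (∀ l → l ≢ index X → quotientVertex l ∈ D) → Guarded (Blocked D) (index X)
  guarded-at (inj₁ i) vi∈D _ = guarded-by-quotient i vi∈D
  guarded-at (inj₂ (i , a)) x∈D others∈D =
    let b , Fab = dominated⇒neighbour F-simple dom 3≤p a
    in (suc a , suc b , edge⇒≢ F-simple Fab ∘ suc-injective , inj₁ x∈D , inj₂ (copyAt i a , x∈D , copyAt-edge i a b Fab)) ,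
       inj₂ (λ l Til → inj₁ (others∈D l (tree-edge⇒≢ Til)))

  transversal-isolating : ∀ X → Isolating F G (transversal X)
  transversal-isolating X C =
    no-copy-avoiding (InClosedNbhd G D) (proj₁ ∘ guarded) (proj₂ ∘ guarded) f (injective _ _) preserves avoids
    where
      open CopyOutside C
      D = transversal X
      others∈D = quotientVertex-∈-transversal X
      guarded : ∀ j → Guarded (Blocked D) j
      guarded j with j ≟ index X
      ... | no j≢ = guarded-by-quotient j (others∈D j j≢)
      ... | yes refl = guarded-at X (from-∈-transversal X) others∈D

  minimumIsolating-∋ : ∀ x → Σ (Subset n) λ D → MinIsolating F G D × x ∈ D
  minimumIsolating-∋ x =
    transversal (to x) ,
    (transversal-isolating (to x) , λ D′ D′-isolating → ≤-trans (∣transversal∣≤q (to x)) (isolating⇒q≤∣∣ D′-isolating)) ,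
    subst (_∈ transversal (to x)) (from-to x) (from-∈-transversal (to x))

  ι≡q : ∀ {k} → IotaIs G F k → k ≡ q
  ι≡q (D , (D-isolating , D-minimum) , refl) =
    ≤-antisym (≤-trans (D-minimum _ (transversal-isolating X₀)) (∣transversal∣≤q X₀)) (isolating⇒q≤∣∣ D-isolating)
    where X₀ = inj₁ (fromℕ< q≥1)

module VertexDeletion {p n m} {F : Graph p} {G : Graph (suc n)} (F-simple : SimpleGraph F)
                      (dom : DominationNumberOne F) (3≤p : 3 ≤ p) (R : Representation m F G)
                      (x : Fin (suc n)) {i a₀} (x-in-copy : Inverse.to (Representation.φ R) x ≡ inj₂ (i , a₀)) where

  open PureSpecial F-simple dom 3≤p R

  G-x : Graph n
  G-x = deleteVertex G x

  D″ : Subset n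
  D″ = removeAt (transversal (to x)) x

  suc∣D″∣≤q : suc ∣ D″ ∣ ≤ q
  suc∣D″∣≤q = begin
    suc ∣ D″ ∣                                         ≡⟨ ∣insertAt-inside∣ D″ x ⟨
    ∣ insertAt D″ x inside ∣                           ≡⟨ cong (λ b → ∣ insertAt D″ x b ∣) x∈D ⟨
    ∣ insertAt D″ x (lookup (transversal (to x)) x) ∣   ≡⟨ cong ∣_∣ (insertAt-removeAt (transversal (to x)) x) ⟩
    ∣ transversal (to x) ∣                             ≤⟨ ∣transversal∣≤q (to x) ⟩
    q                                                  ∎
    where
      open ≤-Reasoning
      x∈D : lookup (transversal (to x)) x ≡ inside
      x∈D = []=⇒lookup (subst (_∈ transversal (to x)) (from-to x) (from-∈-transversal (to x)))

  q≤suc∣∣ : ∀ {D′} → Isolating F G-x D′ → q ≤ suc ∣ D′ ∣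
  q≤suc∣∣ {D′} D′-isolating = subst (q ≤_) (∣insertAt-inside∣ D′ x) (isolating⇒q≤∣∣ (isolating-insertAt x D′-isolating))

  D″-isolating : ∀ {l} → T l i ≡ true → Isolating F G-x D″
  D″-isolating {l} Tli C =
    no-copy-avoiding B (proj₁ ∘ guarded) (proj₂ ∘ guarded) (punchIn x ∘ f)
      (injective _ _ ∘ punchIn-injective x _ _) preserves (copy-in-deletion {G = G} x C)
    where
      open CopyOutside C
      D₀ = insertAt D″ x outside
      B : Fin (suc n) → Set
      B u = u ≡ x ⊎ InClosedNbhd G D₀ u
      index-x : index (to x) ≡ i
      index-x = cong index x-in-copy
      others∈D₀ : ∀ j → j ≢ i → quotientVertex j ∈ D₀
      others∈D₀ j j≢i = ∈-insertAt-removeAt outside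
        (λ x≡vj → j≢i (sym (trans (sym index-x) (trans (cong (index ∘ to) x≡vj) (cong index (to-from _))))))
        (quotientVertex-∈-transversal (to x) j (j≢i ∘ flip trans index-x))
      vi-blocked : B (quotientVertex i)
      vi-blocked = inj₂ (inj₂ (quotientVertex l , others∈D₀ l (tree-edge⇒≢ Tli ∘ sym) , from-edge _ _ Tli))
      guarded : ∀ j → Guarded (B ∘ from) j
      guarded j with j ≟ i
      ... | no j≢i = Guarded-map {B = Blocked D₀} {B′ = B ∘ from} inj₂ (guarded-by-quotient j (others∈D₀ j j≢i))
      ... | yes refl = (zero , suc a₀ , (λ ()) , vi-blocked , inj₁ x-slot) , inj₁ vi-blocked
        where x-slot : from (inj₂ (i , a₀)) ≡ x
              x-slot = trans (cong from (sym x-in-copy)) (from-to x)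

  ι-deletion : Isolating F G-x D″ → ∀ k → IotaIs G F k → IotaIs G-x F (k ∸ 1)
  ι-deletion D″-iso k ι =
    D″ , (D″-iso , λ D′ D′-iso → ≤-pred (≤-trans suc∣D″∣≤q (q≤suc∣∣ D′-iso))) , ∣D″∣≡k∸1
    where
      ∣D″∣≡k∸1 : ∣ D″ ∣ ≡ k ∸ 1
      ∣D″∣≡k∸1 = cong (_∸ 1) (trans (≤-antisym suc∣D″∣≤q (q≤suc∣∣ D″-iso)) (sym (ι≡q ι)))

-- Relabel G − x by Fin p, with the quotient vertex in the slot of a₀. The copy becomes a
-- permutation σ embedding F into a graph H that differs from F only at a₀, where H has
-- degree ≤ 1; comparing degree sums makes σ an isomorphism and a₀ a leaf of F, so x can
-- take the place of the quotient vertex.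
module Reroot {p} {F : Graph (suc p)} (F-simple : SimpleGraph F) {T : Graph 1} (T-simple : SimpleGraph T)
              (w : Fin 1 → Fin (suc p)) (a₀ : Fin (suc p)) {b} (Fa₀b : F a₀ b ≡ true)
              (g : Fin (suc p) → SVertex 1 (suc p)) (g-inj : Injective _≡_ _≡_ g)
              (g-hom : EdgePreserving F (specialAdj T F w) g) (g-avoids : ∀ a → g a ≢ inj₂ (zero , a₀)) where

  open SpecialAdjacency {F = F} T w

  X : SVertex 1 (suc p)
  X = inj₂ (zero , a₀)

  slot : Fin (suc p) → SVertex 1 (suc p)
  slot s with s ≟ a₀
  ... | yes _ = inj₁ zero
  ... | no _ = inj₂ (zero , s)

  unslot : SVertex 1 (suc p) → Fin (suc p)
  unslot (inj₁ _) = a₀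
  unslot (inj₂ (_ , s)) = s

  slot-other : ∀ {s} → s ≢ a₀ → slot s ≡ inj₂ (zero , s)
  slot-other {s} s≢a₀ with s ≟ a₀
  ... | yes s≡a₀ = contradiction s≡a₀ s≢a₀
  ... | no _ = refl

  unslot-slot : ∀ s → unslot (slot s) ≡ s
  unslot-slot s with s ≟ a₀
  ... | yes s≡a₀ = sym s≡a₀
  ... | no _ = refl

  slot-unslot : ∀ Y → Y ≢ X → slot (unslot Y) ≡ Y
  slot-unslot (inj₁ zero) _ with a₀ ≟ a₀
  ... | yes _ = refl
  ... | no a₀≢a₀ = contradiction refl a₀≢a₀
  slot-unslot (inj₂ (zero , s)) Y≢X = slot-other (λ { refl → Y≢X refl })

  σ : Fin (suc p) → Fin (suc p)
  σ = unslot ∘ g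

  g≡slot∘σ : ∀ a → g a ≡ slot (σ a)
  g≡slot∘σ a = sym (slot-unslot (g a) (g-avoids a))

  π : Permutation (suc p) (suc p)
  π = injective⇒permutation σ (λ eq → g-inj (trans (g≡slot∘σ _) (trans (cong slot eq) (sym (g≡slot∘σ _)))))

  H : Graph (suc p)
  H s t = S (slot s) (slot t)

  H-simple : SimpleGraph H
  H-simple = (λ s t → S-symmetric T-simple F-simple (slot s) (slot t))
           , (λ s → S-loopless T-simple F-simple (slot s))

  H-agrees : ∀ s t → F (punchIn a₀ s) (punchIn a₀ t) ≡ H (punchIn a₀ s) (punchIn a₀ t)
  H-agrees s t rewrite slot-other (punchInᵢ≢i a₀ s) | slot-other (punchInᵢ≢i a₀ t) = sym (copy-edge zero _ _)

  F⊆Hσ : EdgePreserving F H σ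
  F⊆Hσ a a′ Faa′ = subst₂ (λ Y Z → S Y Z ≡ true) (g≡slot∘σ a) (g≡slot∘σ a′) (g-hom a a′ Faa′)

  slot-a₀ : slot a₀ ≡ inj₁ zero
  slot-a₀ with a₀ ≟ a₀
  ... | yes _ = refl
  ... | no a₀≢a₀ = contradiction refl a₀≢a₀

  H-a₀-neighbour : ∀ t → H a₀ t ≡ true → t ≡ w zero
  H-a₀-neighbour t adj with quotient-neighbour zero (slot t) (subst (λ Y → S Y (slot t) ≡ true) slot-a₀ adj)
  ... | inj₁ (zero , _ , T00) = contradiction (trans (sym T00) (proj₂ T-simple zero)) λ ()
  ... | inj₂ slot-t≡ = trans (sym (unslot-slot t)) (cong unslot slot-t≡)

  open VertexModification F-simple H-simple a₀ H-agrees π F⊆Hσ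

  degree-H-a₀≤1 : degree H a₀ ≤ 1
  degree-H-a₀≤1 = degree≤1 H a₀ (w zero) H-a₀-neighbour

  1≤degree-F-a₀ : 1 ≤ degree F a₀
  1≤degree-F-a₀ = 1≤degree F a₀ b Fa₀b

  a₀≢w : a₀ ≢ w zero
  a₀≢w a₀≡w = contradiction (≤-trans 1≤degree-F-a₀ (≤-trans degree-mono (≤-reflexive isolated))) λ ()
    where
      isolated : degree H a₀ ≡ 0
      isolated = degree≡0 H a₀ no-neighbour
        where
          no-neighbour : ∀ t → H a₀ t ≡ false
          no-neighbour t with H a₀ t in adj
          ... | false = refl
          ... | true with refl ← trans (H-a₀-neighbour t adj) (sym a₀≡w) = trans (sym adj) (proj₂ H-simple a₀)

  F-a₀-neighbour : ∀ t → F a₀ t ≡ true → t ≡ b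
  F-a₀-neighbour t Fa₀t = degree≤1⇒unique F a₀ t b (≤-trans degree-mono degree-H-a₀≤1) Fa₀t Fa₀b

  g-reflects : ∀ s t → S (g s) (g t) ≡ true → F s t ≡ true
  g-reflects s t adj = reflects (≤-trans degree-H-a₀≤1 1≤degree-F-a₀) s t
    (subst₂ (λ Y Z → S Y Z ≡ true) (g≡slot∘σ s) (g≡slot∘σ t) adj)

  X-neighbour : ∀ Y → S X Y ≡ true → Y ≡ inj₂ (zero , b)
  X-neighbour Y adj with copy-neighbour zero a₀ Y adj
  ... | zero , refl = contradiction (≟-sound (∧-conicalʳ _ _ adj)) a₀≢w
  ... | suc s , refl = cong (λ t → inj₂ (zero , t)) (F-a₀-neighbour s (trans (sym (copy-edge zero a₀ s)) adj))

  b≢a₀ : b ≢ a₀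
  b≢a₀ = edge⇒≢ F-simple Fa₀b ∘ sym

  σ⁻¹ : Fin (suc p) → Fin (suc p)
  σ⁻¹ = π ⟨$⟩ˡ_

  X-edge : ∀ t → S X (g t) ≡ ⌊ t ≟ σ⁻¹ b ⌋
  X-edge t = ⇔→≡ {z = true} (mk⇔ ⇒ ⇐)
    where
      ⇒ : S X (g t) ≡ true → ⌊ t ≟ σ⁻¹ b ⌋ ≡ true
      ⇒ adj = subst (λ s → ⌊ t ≟ s ⌋ ≡ true) (trans (sym (inverseˡ π)) (cong σ⁻¹ (cong unslot (X-neighbour (g t) adj)))) (≟-refl t)
      ⇐ : ⌊ t ≟ σ⁻¹ b ⌋ ≡ true → S X (g t) ≡ true
      ⇐ t≡ with refl ← ≟-sound t≡ =
        subst (λ Y → S X Y ≡ true) (sym (trans (g≡slot∘σ (σ⁻¹ b)) (trans (cong slot (inverseʳ π)) (slot-other b≢a₀))))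
              (trans (copy-edge zero a₀ b) Fa₀b)

  w′ : Fin 1 → Fin (suc p)
  w′ _ = σ⁻¹ b

  unrelabel : SVertex 1 (suc p) → SVertex 1 (suc p)
  unrelabel (inj₁ _) = X
  unrelabel (inj₂ (_ , t)) = g t

  relabel : SVertex 1 (suc p) → SVertex 1 (suc p)
  relabel Y with Y ≟ᵥ X
  ... | yes _ = inj₁ zero
  ... | no _ = inj₂ (zero , σ⁻¹ (unslot Y))

  relabel-unrelabel : ∀ Y → relabel (unrelabel Y) ≡ Y
  relabel-unrelabel (inj₁ zero) with X ≟ᵥ X
  ... | yes _ = refl
  ... | no X≢X = contradiction refl X≢X
  relabel-unrelabel (inj₂ (zero , t)) with g t ≟ᵥ X
  ... | yes gt≡X = contradiction gt≡X (g-avoids t)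
  ... | no _ = cong (λ s → inj₂ (zero , s)) (inverseˡ π)

  unrelabel-relabel : ∀ Y → unrelabel (relabel Y) ≡ Y
  unrelabel-relabel Y with Y ≟ᵥ X
  ... | yes Y≡X = sym Y≡X
  ... | no Y≢X = trans (g≡slot∘σ _) (trans (cong slot (inverseʳ π)) (slot-unslot Y Y≢X))

  relabelling : SVertex 1 (suc p) ↔ SVertex 1 (suc p)
  relabelling = mk↔ₛ′ relabel unrelabel relabel-unrelabel unrelabel-relabel

  unrelabel-edge : ∀ Y Z → S (unrelabel Y) (unrelabel Z) ≡ specialAdj T F w′ Y Z
  unrelabel-edge (inj₁ zero) (inj₁ zero) =
    trans (S-loopless T-simple F-simple X) (sym (proj₂ T-simple zero))
  unrelabel-edge (inj₁ zero) (inj₂ (zero , t)) = X-edge t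
  unrelabel-edge (inj₂ (zero , t)) (inj₁ zero) = trans (S-symmetric T-simple F-simple (g t) X) (X-edge t)
  unrelabel-edge (inj₂ (zero , s)) (inj₂ (zero , t)) = ⇔→≡ {z = true} (mk⇔ (g-reflects s t) (g-hom s t))

  relabel-edge : ∀ Y Z → S Y Z ≡ specialAdj T F w′ (relabel Y) (relabel Z)
  relabel-edge Y Z = trans (sym (cong₂ S (unrelabel-relabel Y) (unrelabel-relabel Z))) (unrelabel-edge (relabel Y) (relabel Z))

module SpanningCopy {p n} {F : Graph p} {G : Graph n} (ψ : Fin n ↔ Fin p) (F⊆G : EdgePreserving F G (Inverse.from ψ)) where

  private
    from-injective : Injective _≡_ _≡_ (Inverse.from ψ)
    from-injective eq = trans (sym (Inverse.strictlyInverseˡ ψ _)) (trans (cong (Inverse.to ψ) eq) (Inverse.strictlyInverseˡ ψ _))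

    to-injective : Injective _≡_ _≡_ (Inverse.to ψ)
    to-injective eq = trans (sym (Inverse.strictlyInverseʳ ψ _)) (trans (cong (Inverse.from ψ) eq) (Inverse.strictlyInverseʳ ψ _))

  singleton-isolating : ∀ x → Isolating F G ⁅ x ⁆
  singleton-isolating x C = <⇒≱ (injective-avoiding⇒< f (injective _ _) f≢x) (injective⇒≤ to-injective)
    where
      open CopyOutside C
      f≢x : ∀ a → f a ≢ x
      f≢x a fa≡x = avoids a (inj₁ (subst (_∈ ⁅ x ⁆) (sym fa≡x) (x∈⁅x⁆ x)))

  minimumIsolating-∋ : ∀ x → Σ (Subset n) λ D → MinIsolating F G D × x ∈ D
  minimumIsolating-∋ x = ⁅ x ⁆ , (singleton-isolating x , 1≤∣∣) , x∈⁅x⁆ x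
    where
      1≤∣∣ : ∀ D′ → Isolating F G D′ → ∣ ⁅ x ⁆ ∣ ≤ ∣ D′ ∣
      1≤∣∣ D′ D′-isolating rewrite ∣⁅x⁆∣≡1 x with isolating⇒meets D′-isolating (Inverse.from ψ) from-injective F⊆G
      ... | _ , inj₁ d∈D′ = nonempty⇒1≤∣∣ d∈D′
      ... | _ , inj₂ (_ , d∈D′ , _) = nonempty⇒1≤∣∣ d∈D′

plusEdge-spanning : ∀ {p n} {F : Graph p} {G : Graph n} → IsCopyOfPlusEdge F G →
                    Σ (Fin n ↔ Fin p) λ ψ → EdgePreserving F G (Inverse.from ψ)
plusEdge-spanning {F = F} (a , b , _ , _ , ψ , G≅F+ab) = ψ , λ s t Fst →
  trans (G≅F+ab _ _) (subst₂ (λ s′ t′ → plusEdge F a b s′ t′ ≡ true)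
                             (sym (Inverse.strictlyInverseˡ ψ s)) (sym (Inverse.strictlyInverseˡ ψ t)) (cong (_∨ _) Fst))

deletion-isolating : ∀ {p n m} {F : Graph p} {G : Graph (suc n)} (F-simple : SimpleGraph F)
  (dom : DominationNumberOne F) (3≤p : 3 ≤ p) (R : Representation m F G) (x : Fin (suc n)) {i a₀}
  (x-in-copy : Inverse.to (Representation.φ R) x ≡ inj₂ (i , a₀)) →
  (∀ (R′ : Representation m F G) → ¬ IsQuotientVertex R′ x) →
  Isolating F (deleteVertex G x) (VertexDeletion.D″ F-simple dom 3≤p R x x-in-copy)
deletion-isolating {suc p} {F = F} F-simple dom 3≤p R@record { q = suc zero } x {zero} {a₀} x-in-copy not-quotient C =
  not-quotient R′ (zero , trans (cong from (sym x-in-copy)) (from-to x))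
  where
    open PureSpecial F-simple dom 3≤p R
    open CopyOutside C
    g = to ∘ punchIn x ∘ f
    module R = Reroot F-simple (proj₁ T-tree) w a₀ (proj₂ (dominated⇒neighbour F-simple dom 3≤p a₀)) g
      (injective _ _ ∘ punchIn-injective x _ _ ∘ to-injective) (λ a b → to-edge ∘ preserves a b)
      (λ a ga≡ → punchInᵢ≢i x (f a) (to-injective (trans ga≡ (sym x-in-copy))))
    R′ : Representation _ F _
    R′ = record { q = 1 ; q≥1 = q≥1 ; count = count ; T = T ; T-tree = T-tree ; w = R.w′ ; φ = R.relabelling ↔-∘ φ
                ; edges = λ u v → trans (edges u v) (R.relabel-edge (to u) (to v)) }
deletion-isolating F-simple dom 3≤p R@record { q = suc (suc q) ; T-tree = T-tree@((T-sym , _) , T-connected , _) } x {i} x-in-copy _ =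
  let l , Til = walk-first-step (T-connected i (punchIn i zero)) (punchInᵢ≢i i zero ∘ sym)
  in D″-isolating (trans (T-sym l i) Til)
  where open VertexDeletion F-simple dom 3≤p R x x-in-copy

deletion-ι : ∀ {p n m} {F : Graph p} {G : Graph n} → SimpleGraph F → DominationNumberOne F → 3 ≤ p →
             (R : Representation m F G) (x : Fin n) → (∀ (R′ : Representation m F G) → ¬ IsQuotientVertex R′ x) →
             ∀ k → IotaIs G F k → IotaIs (deleteVertex G x) F (k ∸ 1)
deletion-ι {n = suc n} F-simple dom 3≤p R x not-quotient with PureSpecial.quotientVertex-or-copyVertex F-simple dom 3≤p R x
... | inj₁ x-quotient = contradiction x-quotient (not-quotient R)
... | inj₂ (_ , _ , x-in-copy) =
  VertexDeletion.ι-deletion F-simple dom 3≤p R x x-in-copy (deletion-isolating F-simple dom 3≤p R x x-in-copy not-quotient)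

lemma3p4 : ∀ {p} (F : Graph p) → SimpleGraph F → DominationNumberOne F →
    3 ≤ edgeCount F →
    ∀ {n} (G : Graph n) →
    ((Σ ℕ λ m → IsPureSpecial m F G) ⊎ IsCopyOfPlusEdge F G) →
    ((x : Fin n) → Σ (Subset n) λ D → MinIsolating F G D × x ∈ D)
    × (∀ (m : ℕ) → IsPureSpecial m F G → (x : Fin n) →
    (∀ (R : Representation m F G) → ¬ IsQuotientVertex R x) →
    ∀ (k : ℕ) → IotaIs G F k → IotaIs (deleteVertex G x) F (k ∸ 1))
lemma3p4 F F-simple dom 3≤edges G special-or-plus =
  [ (λ (_ , R) → PureSpecial.minimumIsolating-∋ F-simple dom 3≤p R)
  , (λ plus → let ψ , F⊆G = plusEdge-spanning plus in SpanningCopy.minimumIsolating-∋ ψ F⊆G) ]′ special-or-plus ,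
  λ _ → deletion-ι F-simple dom 3≤p
  where 3≤p = 3≤edgeCount⇒3≤p F 3≤edges
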